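{- Let $X$ be a set, let $\mathcal{F}\subseteq\mathcal{P}(X)$ be a saturated $k$-Sperner system with a homogeneous set $H$, and let $(\mathcal{A}_i)_{i=0}^{k-1}$ be the canonical decomposition of $\mathcal{F}$. Then $\mathcal{A}_i$ is a saturated antichain for every $i$.
   Context: $\mathcal{F}\subseteq\mathcal{P}(X)$ is a $k$-Sperner system if it contains no $(k+1)$-chain $A_1\subsetneq\dots\subsetneq A_{k+1}$ with all $A_j\in\mathcal{F}$; it is saturated if additionally $\mathcal{F}\cup\{S\}$ contains a $(k+1)$-chain for every $S\in\mathcal{P}(X)\setminus\mathcal{F}$. A set $A\subseteq X$ is an atom for $\mathcal{F}$ if it is maximal with respect to the property that $S\cap A\in\{\emptyset,A\}$ for all $S\in\mathcal{F}$; an atom with $|A|\ge2$ is homogeneous. The canonical decomposition $(\mathcal{A}_i)_{i=0}^{k-1}$ is defined recursively: $\mathcal{A}_i$ is the collection of inclusion-minimal elements of $\mathcal{F}\setminus\bigcup_{j<i}\mathcal{A}_j$. An antichain $\mathcal{A}\subseteq\mathcal{P}(X)$ is saturated if for every $S\in\mathcal{P}(X)\setminus\mathcal{A}$ there is $A\in\mathcal{A}$ with $A\subsetneq S$ or $S\subsetneq A$. -}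

module Defs where

open import Data.Nat using (ℕ; zero; suc; _<_; _≤_)
open import Data.Bool using (Bool; true; false)
open import Data.Fin using (Fin; toℕ)
open import Data.Fin.Subset using (Subset; _⊆_; _⊂_; _∩_; ⊥; ∣_∣)
open import Data.Product using (Σ; _×_; ∃)
open import Data.Sum using (_⊎_)
open import Relation.Nullary using (¬_)
open import Relation.Binary.PropositionalEquality using (_≡_)

-- Ground set X = Fin n.  A family F ⊆ P(X) is given by its (decidable)
-- membership function.
Family : ℕ → Set
Family n = Subset n → Bool

_∈F_ : ∀ {n} → Subset n → Family n → Set
S ∈F F = F S ≡ true

Coll : ℕ → Set₁
Coll n = Subset n → Set

⟦_⟧ : ∀ {n} → Family n → Coll n
⟦ F ⟧ S = S ∈F F

_∪1_ : ∀ {n} → Coll n → Subset n → Coll n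
(C ∪1 S) T = C T ⊎ T ≡ S

HasChain : ∀ {n} → Coll n → ℕ → Set
HasChain {n} C m =
  Σ (Fin m → Subset n) λ c →
    (∀ j → C (c j)) × (∀ (i j : Fin m) → toℕ i < toℕ j → c i ⊂ c j)

KSperner : ∀ {n} → ℕ → Family n → Set
KSperner k F = ¬ HasChain ⟦ F ⟧ (suc k)

SaturatedKSperner : ∀ {n} → ℕ → Family n → Set
SaturatedKSperner {n} k F =
  KSperner k F ×
  (∀ (S : Subset n) → ¬ (S ∈F F) → HasChain (⟦ F ⟧ ∪1 S) (suc k))

Splitless : ∀ {n} → Family n → Subset n → Set
Splitless {n} F A = ∀ (S : Subset n) → S ∈F F → (S ∩ A ≡ ⊥ ⊎ S ∩ A ≡ A)

Atom : ∀ {n} → Family n → Subset n → Set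
Atom {n} F A = Splitless F A × (∀ (B : Subset n) → A ⊆ B → Splitless F B → B ≡ A)

Homogeneous : ∀ {n} → Family n → Subset n → Set
Homogeneous F H = Atom F H × 2 ≤ ∣ H ∣

Minimal : ∀ {n} → Coll n → Coll n
Minimal {n} C S = C S × (∀ (T : Subset n) → T ⊂ S → ¬ C T)

-- Rest F i = F \ (A_0 ∪ ... ∪ A_{i-1})
Rest : ∀ {n} → Family n → ℕ → Coll n
Rest F zero S = S ∈F F
Rest F (suc i) S = Rest F i S × ¬ Minimal (Rest F i) S

Canonical : ∀ {n} → Family n → ℕ → Coll n
Canonical F i = Minimal (Rest F i)

SaturatedAntichain : ∀ {n} → Coll n → Set
SaturatedAntichain {n} C =
  (∀ (A B : Subset n) → C A → C B → A ⊆ B → A ≡ B) ×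
  (∀ (S : Subset n) → ¬ C S → ∃ λ A → C A × (A ⊂ S ⊎ S ⊂ A))

-- A k-chain c₀ ⊂ … ⊂ c_{k-1} in a k-Sperner family F runs through the canonical decomposition:
-- cₗ ∈ 𝒜ₗ, since each step up the chain raises the level by one, and a member lying strictly above
-- its level would let the chain be extended to length k + 1. Now let S ∉ 𝒜ᵢ. If S ∉ F, saturation
-- gives a (k+1)-chain in F ∪ {S}; deleting S leaves a k-chain whose i-th member lies in 𝒜ᵢ and is
-- comparable with S. If S ∈ F, take x ≠ y in the homogeneous set, so that every member of F
-- containing x contains y, and put T = (S ∪ {x}) ∖ {y}. Then T ∉ F, and members of F below
-- (above) T are below (above) S. In a (k+1)-chain through T either S occurs, and we conclude as
-- before, or T can be replaced by S, giving a (k+1)-chain in F.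

module Submission where

open import Defs
open import Data.Nat using (ℕ; zero; suc; _+_; _<_; _≤_; s≤s; z≤n)
open import Data.Nat.Properties using (+-suc; +-identityʳ; <-cmp; <-irrefl; ≰⇒>; <⇒≱)
open import Data.Bool using (true)
import Data.Bool as Bool
open import Data.Fin using (Fin; zero; suc; toℕ; fromℕ<; punchIn) renaming (_≟_ to _≟ᶠ_)
open import Data.Fin.Properties using (toℕ-injective; toℕ-fromℕ<; punchInᵢ≢i; punchIn-cancel-≤; any?; suc-injective; <⇒≢)
open import Data.Fin.Subset using (Subset; _⊆_; _⊂_; _∈_; _∉_; _∪_; _∩_; ∁; ⁅_⁆; ∣_∣; Nonempty; inside; outside)
open import Data.Fin.Subset.Properties
  using (_∈?_; _⊂?_; ⊆-antisym; ⊂-trans; ⊂-irref; ∉⊥; x∈p∩q⁺; x∈p∩q⁻; x∈p∪q⁺; x∈p∪q⁻; p⊆p∪q;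
         x∈⁅x⁆; x∈⁅y⁆⇒x≡y; x≢y⇒x∉⁅y⁆; x∉p⇒x∈∁p; x∈∁p⇒x∉p)
open import Data.Vec using (_∷_; here; there)
open import Data.Vec.Properties using (≡-dec)
open import Data.Vec.Functional using (updateAt; removeAt) renaming (_∷_ to _◂_)
open import Data.Vec.Functional.Properties using (updateAt-updates; updateAt-minimal)
open import Data.Product using (∃; ∃₂; _×_; _,_; proj₁; proj₂)
open import Data.Sum using (_⊎_; inj₁; inj₂; [_,_]′)
open import Data.Empty using (⊥-elim)
open import Function using (id; _∘_; const)
open import Relation.Nullary using (¬_; Dec; yes; no; contradiction)
open import Relation.Nullary.Decidable using (decidable-stable)
open import Relation.Binary using (tri<; tri≈; tri>)
open import Relation.Binary.PropositionalEquality using (_≡_; _≢_; refl; sym; trans; cong; subst; subst₂)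

private
  variable
    n K : ℕ

_≟ˢ_ : (A B : Subset n) → Dec (A ≡ B)
_≟ˢ_ = ≡-dec Bool._≟_

Comparable : Subset n → Subset n → Set
Comparable A B = A ⊂ B ⊎ B ⊂ A

⊆∧≢⇒⊂ : {A B : Subset n} → A ⊆ B → A ≢ B → A ⊂ B
⊆∧≢⇒⊂ {A = A} {B} A⊆B A≢B with A ⊂? B
... | yes A⊂B = A⊂B
... | no A⊄B = contradiction (⊆-antisym A⊆B B⊆A) A≢B
  where
  B⊆A : B ⊆ A
  B⊆A {x} x∈B = decidable-stable (x ∈? A) (λ x∉A → A⊄B (A⊆B , x , x∈B , x∉A))

1≤∣p∣⇒Nonempty : (p : Subset n) → 1 ≤ ∣ p ∣ → Nonempty p
1≤∣p∣⇒Nonempty (inside ∷ p) _ = zero , here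
1≤∣p∣⇒Nonempty (outside ∷ p) 1≤∣p∣ with 1≤∣p∣⇒Nonempty p 1≤∣p∣
... | x , x∈p = suc x , there x∈p

2≤∣p∣⇒distinct-elements : (p : Subset n) → 2 ≤ ∣ p ∣ → ∃₂ λ x y → x ≢ y × x ∈ p × y ∈ p
2≤∣p∣⇒distinct-elements (inside ∷ p) (s≤s 1≤∣p∣) with 1≤∣p∣⇒Nonempty p 1≤∣p∣
... | y , y∈p = zero , suc y , (λ ()) , here , there y∈p
2≤∣p∣⇒distinct-elements (outside ∷ p) 2≤∣p∣ with 2≤∣p∣⇒distinct-elements p 2≤∣p∣
... | x , y , x≢y , x∈p , y∈p = suc x , suc y , x≢y ∘ suc-injective , there x∈p , there y∈p

Minimal-antichain : (C : Coll n) → ∀ A B → Minimal C A → Minimal C B → A ⊆ B → A ≡ B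
Minimal-antichain C A B (A∈C , _) (_ , B-minimal) A⊆B =
  decidable-stable (A ≟ˢ B) (λ A≢B → B-minimal A (⊆∧≢⇒⊂ A⊆B A≢B) A∈C)

Increasing : (Fin K → Subset n) → Set
Increasing c = ∀ i j → toℕ i < toℕ j → c i ⊂ c j

module _ {c : Fin K → Subset n} (inc : Increasing c) where

  Increasing⇒comparable : ∀ {i j} → i ≢ j → Comparable (c i) (c j)
  Increasing⇒comparable {i} {j} i≢j with <-cmp (toℕ i) (toℕ j)
  ... | tri< i<j _ _ = inj₁ (inc i j i<j)
  ... | tri≈ _ i≡j _ = contradiction (toℕ-injective i≡j) i≢j
  ... | tri> _ _ j<i = inj₂ (inc j i j<i)

  Increasing-injective : ∀ {i j} → c i ≡ c j → i ≡ j
  Increasing-injective {i} {j} cᵢ≡cⱼ = decidable-stable (i ≟ᶠ j)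
    (λ i≢j → [ ⊂-irref cᵢ≡cⱼ , ⊂-irref (sym cᵢ≡cⱼ) ]′ (Increasing⇒comparable i≢j))

  Increasing-updateAt : ∀ {g S} → (∀ m → toℕ m < toℕ g → c m ⊂ S) → (∀ m → toℕ g < toℕ m → S ⊂ c m)
                        → Increasing (updateAt c g (const S))
  Increasing-updateAt {g} {S} below above a b a<b with a ≟ᶠ g | b ≟ᶠ g
  ... | yes refl | yes refl = contradiction a<b (<-irrefl refl)
  ... | yes refl | no b≢g = subst₂ _⊂_ (sym (updateAt-updates g c)) (sym (updateAt-minimal b g c b≢g)) (above b a<b)
  ... | no a≢g | yes refl = subst₂ _⊂_ (sym (updateAt-minimal a g c a≢g)) (sym (updateAt-updates g c)) (below a a<b)
  ... | no a≢g | no b≢g =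
    subst₂ _⊂_ (sym (updateAt-minimal a g c a≢g)) (sym (updateAt-minimal b g c b≢g)) (inc a b a<b)

Increasing-tail : {c : Fin (suc K) → Subset n} → Increasing c → Increasing (c ∘ suc)
Increasing-tail inc i j i<j = inc (suc i) (suc j) (s≤s i<j)

Increasing-◂ : {Y : Subset n} {c : Fin (suc K) → Subset n} → Increasing c → Y ⊂ c zero → Increasing (Y ◂ c)
Increasing-◂ inc Y⊂c₀ zero (suc zero) _ = Y⊂c₀
Increasing-◂ inc Y⊂c₀ zero (suc (suc j)) _ = ⊂-trans Y⊂c₀ (inc zero (suc j) (s≤s z≤n))
Increasing-◂ inc Y⊂c₀ (suc i) (suc j) (s≤s i<j) = inc i j i<j

Increasing-removeAt : {c : Fin (suc K) → Subset n} → Increasing c → ∀ g → Increasing (removeAt c g)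
Increasing-removeAt inc g i j i<j = inc (punchIn g i) (punchIn g j) (≰⇒> (<⇒≱ i<j ∘ punchIn-cancel-≤ g j i))

module _ (F : Family n) where

  Rest⇒∈F : ∀ m {S} → Rest F m S → S ∈F F
  Rest⇒∈F zero S∈F = S∈F
  Rest⇒∈F (suc m) (S∈Rest , _) = Rest⇒∈F m S∈Rest

  Rest-upward : ∀ m {A B} → Rest F m A → B ∈F F → A ⊂ B → Rest F m B
  Rest-step : ∀ m {A B} → Rest F m A → B ∈F F → A ⊂ B → Rest F (suc m) B

  Rest-upward zero _ B∈F _ = B∈F
  Rest-upward (suc m) (A∈Rest , _) = Rest-step m A∈Rest

  Rest-step m A∈Rest B∈F A⊂B = Rest-upward m A∈Rest B∈F A⊂B , λ B-minimal → proj₂ B-minimal _ A⊂B A∈Rest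

  -- Membership in Rest (m + 1) only says "not minimal", so the element below is obtained
  -- under a double negation; this is harmless as it is only used to refute k-Sperner.
  Rest⇒¬¬longChain : ∀ m {r} (c : Fin (suc r) → Subset n) → (∀ j → c j ∈F F) → Increasing c
                     → Rest F m (c zero) → ¬ ¬ HasChain ⟦ F ⟧ (suc (m + r))
  Rest⇒¬¬longChain zero c c∈F inc _ noChain = noChain (c , c∈F , inc)
  Rest⇒¬¬longChain (suc m) {r} c c∈F inc (c₀∈Rest , c₀-not-minimal) noChain =
    c₀-not-minimal (c₀∈Rest , λ Y Y⊂c₀ Y∈Rest →
      Rest⇒¬¬longChain m (Y ◂ c) (λ { zero → Rest⇒∈F m Y∈Rest ; (suc j) → c∈F j })
        (Increasing-◂ inc Y⊂c₀) Y∈Rest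
        (noChain ∘ subst (HasChain ⟦ F ⟧) (cong suc (+-suc m r))))

  chain-canonical : ∀ s {r} (c : Fin (suc r) → Subset n) → (∀ j → c j ∈F F) → Increasing c
                    → ¬ HasChain ⟦ F ⟧ (suc (s + suc r)) → Rest F s (c zero) → ∀ l → Canonical F (s + toℕ l) (c l)
  chain-canonical s {r} c c∈F inc noChain c₀∈Rest zero =
    subst (λ m → Canonical F m (c zero)) (sym (+-identityʳ s)) (c₀∈Rest , c₀-minimal)
    where
    c₀-minimal : ∀ T → T ⊂ c zero → ¬ Rest F s T
    c₀-minimal T T⊂c₀ T∈Rest =
      Rest⇒¬¬longChain (suc s) c c∈F inc (Rest-step s T∈Rest (c∈F zero) T⊂c₀)
        (noChain ∘ subst (HasChain ⟦ F ⟧) (cong suc (sym (+-suc s r))))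
  chain-canonical s {zero} c _ _ _ _ (suc ())
  chain-canonical s {suc r} c c∈F inc noChain c₀∈Rest (suc l) =
    subst (λ m → Canonical F m (c (suc l))) (sym (+-suc s (toℕ l)))
      (chain-canonical (suc s) (c ∘ suc) (c∈F ∘ suc) (Increasing-tail inc)
        (noChain ∘ subst (HasChain ⟦ F ⟧) (cong suc (sym (+-suc s (suc r)))))
        (Rest-step s c₀∈Rest (c∈F (suc zero)) (inc zero (suc zero) (s≤s z≤n))) l)

  chain-levels : ∀ {k} → KSperner k F → (c : Fin k → Subset n) → (∀ j → c j ∈F F) → Increasing c
                 → ∀ l → Canonical F (toℕ l) (c l)
  chain-levels {suc r} sperner c c∈F inc = chain-canonical 0 c c∈F inc sperner (c∈F zero)

  record ChainThrough (k : ℕ) (T : Subset n) : Set where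
    field
      chain      : Fin (suc k) → Subset n
      increasing : Increasing chain
      gap        : Fin (suc k)
      chain-gap  : chain gap ≡ T
      chain-∈F   : ∀ m → m ≢ gap → chain m ∈F F

  saturated⇒chainThrough : ∀ {k T} → SaturatedKSperner k F → ¬ T ∈F F → ChainThrough k T
  saturated⇒chainThrough {k} {T} (sperner , saturated) T∉F with saturated T T∉F
  ... | c , c∈F∪T , inc with any? (λ m → c m ≟ˢ T)
  ...   | yes (g , cg≡T) = record
    { chain = c ; increasing = inc ; gap = g ; chain-gap = cg≡T
    ; chain-∈F = λ m m≢g → [ id , (λ cₘ≡T → contradiction (Increasing-injective inc (trans cₘ≡T (sym cg≡T))) m≢g) ]′
                             (c∈F∪T m)
    }
  ...   | no T∉c =
    ⊥-elim (sperner (c , (λ m → [ id , (λ cₘ≡T → contradiction (m , cₘ≡T) T∉c) ]′ (c∈F∪T m)) , inc))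

  module _ {k T} (through : ChainThrough k T) where
    open ChainThrough through

    fill-gap : ∀ {S} → S ∈F F → (∀ m → chain m ≢ S)
               → (∀ {Y} → Y ∈F F → Y ⊆ T → Y ⊆ S) → (∀ {Y} → Y ∈F F → T ⊆ Y → S ⊆ Y)
               → HasChain ⟦ F ⟧ (suc k)
    fill-gap {S} S∈F S∉chain below above =
      updateAt chain gap (const S) , filled-∈F , Increasing-updateAt increasing chain<S S<chain
      where
      filled-∈F : ∀ m → updateAt chain gap (const S) m ∈F F
      filled-∈F m with m ≟ᶠ gap
      ... | yes refl = subst (_∈F F) (sym (updateAt-updates gap chain)) S∈F
      ... | no m≢gap = subst (_∈F F) (sym (updateAt-minimal m gap chain m≢gap)) (chain-∈F m m≢gap)
      chain<S : ∀ m → toℕ m < toℕ gap → chain m ⊂ S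
      chain<S m m<gap = ⊆∧≢⇒⊂
        (below (chain-∈F m (<⇒≢ m<gap)) (proj₁ (subst (chain m ⊂_) chain-gap (increasing m gap m<gap))))
        (S∉chain m)
      S<chain : ∀ m → toℕ gap < toℕ m → S ⊂ chain m
      S<chain m gap<m = ⊆∧≢⇒⊂
        (above (chain-∈F m (<⇒≢ gap<m ∘ sym)) (proj₁ (subst (_⊂ chain m) chain-gap (increasing gap m gap<m))))
        (S∉chain m ∘ sym)

    module _ (sperner : KSperner k F) {i} (i<k : i < k) where

      comparable-canonical : ∀ {S} m → chain m ≡ S → ¬ Canonical F i S → ∃ λ A → Canonical F i A × Comparable A S
      comparable-canonical m refl S∉Aᵢ = chain m′ , m′∈Aᵢ , Increasing⇒comparable increasing m′≢m
        where
        m′ : Fin (suc k)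
        m′ = punchIn gap (fromℕ< i<k)
        m′∈Aᵢ : Canonical F i (chain m′)
        m′∈Aᵢ = subst (λ j → Canonical F j (chain m′)) (toℕ-fromℕ< i<k)
          (chain-levels sperner (removeAt chain gap) (λ l → chain-∈F _ (punchInᵢ≢i gap l))
            (Increasing-removeAt increasing gap) (fromℕ< i<k))
        m′≢m : m′ ≢ m
        m′≢m m′≡m = S∉Aᵢ (subst (Canonical F i ∘ chain) m′≡m m′∈Aᵢ)

      comparable-canonical-∈F : ∀ {S} → S ∈F F → ¬ Canonical F i S
                                → (∀ {Y} → Y ∈F F → Y ⊆ T → Y ⊆ S) → (∀ {Y} → Y ∈F F → T ⊆ Y → S ⊆ Y)
                                → ∃ λ A → Canonical F i A × Comparable A S
      comparable-canonical-∈F {S} S∈F S∉Aᵢ below above with any? (λ m → chain m ≟ˢ S)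
      ... | yes (m , chainₘ≡S) = comparable-canonical m chainₘ≡S S∉Aᵢ
      ... | no S∉chain = ⊥-elim (sperner (fill-gap S∈F (λ m → S∉chain ∘ (m ,_)) below above))

Forces : Family n → Fin n → Fin n → Set
Forces F x y = ∀ {Y} → Y ∈F F → x ∈ Y → y ∈ Y

Splitless⇒Forces : {F : Family n} {H : Subset n} → Splitless F H → ∀ {x y} → x ∈ H → y ∈ H → Forces F x y
Splitless⇒Forces {F = F} {H} splitless {x} {y} x∈H y∈H {Y} Y∈F x∈Y with splitless Y Y∈F
... | inj₁ Y∩H≡∅ = ⊥-elim (∉⊥ (subst (x ∈_) Y∩H≡∅ (x∈p∩q⁺ (x∈Y , x∈H))))
... | inj₂ Y∩H≡H = proj₁ (x∈p∩q⁻ Y H (subst (y ∈_) (sym Y∩H≡H) y∈H))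

module Separation {F : Family n} {x y : Fin n} (x⇒y : Forces F x y) (x≢y : x ≢ y) where

  separate : Subset n → Subset n
  separate S = (S ∪ ⁅ x ⁆) ∩ ∁ ⁅ y ⁆

  x∈separate : ∀ S → x ∈ separate S
  x∈separate S = x∈p∩q⁺ (x∈p∪q⁺ (inj₂ (x∈⁅x⁆ x)) , x∉p⇒x∈∁p (x≢y⇒x∉⁅y⁆ x≢y))

  y∉separate : ∀ S → y ∉ separate S
  y∉separate S y∈T = x∈∁p⇒x∉p (proj₂ (x∈p∩q⁻ (S ∪ ⁅ x ⁆) _ y∈T)) (x∈⁅x⁆ y)

  separate∉F : ∀ S → ¬ separate S ∈F F
  separate∉F S T∈F = y∉separate S (x⇒y T∈F (x∈separate S))

  ⊆separate⇒⊆ : ∀ {S Y} → Y ∈F F → Y ⊆ separate S → Y ⊆ S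
  ⊆separate⇒⊆ {S} {Y} Y∈F Y⊆T {z} z∈Y with x∈p∪q⁻ S ⁅ x ⁆ (proj₁ (x∈p∩q⁻ _ _ (Y⊆T z∈Y)))
  ... | inj₁ z∈S = z∈S
  ... | inj₂ z∈⁅x⁆ = contradiction (Y⊆T (x⇒y Y∈F (subst (_∈ Y) (x∈⁅y⁆⇒x≡y x z∈⁅x⁆) z∈Y))) (y∉separate S)

  separate⊆⇒⊆ : ∀ {S Y} → Y ∈F F → separate S ⊆ Y → S ⊆ Y
  separate⊆⇒⊆ {S} {Y} Y∈F T⊆Y {z} z∈S with z ≟ᶠ y
  ... | yes refl = x⇒y Y∈F (T⊆Y (x∈separate S))
  ... | no z≢y = T⊆Y (x∈p∩q⁺ (p⊆p∪q ⁅ x ⁆ z∈S , x∉p⇒x∈∁p (x≢y⇒x∉⁅y⁆ z≢y)))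

canonical-saturated : ∀ {k} {F : Family n} {x y} → SaturatedKSperner k F → Forces F x y → x ≢ y
                      → ∀ {i} → i < k → ∀ S → ¬ Canonical F i S → ∃ λ A → Canonical F i A × Comparable A S
canonical-saturated {F = F} saturated@(sperner , _) x⇒y x≢y i<k S S∉Aᵢ with F S Bool.≟ true
... | no S∉F = comparable-canonical F through sperner i<k gap chain-gap S∉Aᵢ
  where
  through = saturated⇒chainThrough F saturated S∉F
  open ChainThrough through
... | yes S∈F = comparable-canonical-∈F F (saturated⇒chainThrough F saturated (separate∉F S)) sperner i<k
                  S∈F S∉Aᵢ ⊆separate⇒⊆ separate⊆⇒⊆
  where open Separation x⇒y x≢y

lemma2p11 : (n k : ℕ) (F : Family n) → SaturatedKSperner k F → (∃ λ (H : Subset n) → Homogeneous F H) → (i : ℕ) → i < k → SaturatedAntichain (Canonical F i)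
lemma2p11 n k F saturated (H , (splitless , _) , 2≤∣H∣) i i<k = Minimal-antichain (Rest F i) , saturation
  where
  saturation : ∀ S → ¬ Canonical F i S → ∃ λ A → Canonical F i A × Comparable A S
  saturation with 2≤∣p∣⇒distinct-elements H 2≤∣H∣
  ... | x , y , x≢y , x∈H , y∈H = canonical-saturated saturated (Splitless⇒Forces splitless x∈H y∈H) x≢y i<k
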